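{- $\#\mathsf{RH\Pi_1}\subseteq \mathsf{\Sigma QSO(\Sigma_2\text{ - }2SAT)}$.
   Context: Fix a relational vocabulary $\sigma$; counting functions are functions from finite ordered $\sigma$-structures to $\mathbb{N}$. First-order formulae over $\sigma$ are built by the grammar $\phi ::= x=y \mid R(\vec x) \mid \neg\phi \mid \phi\vee\phi \mid \exists x\phi \mid \top \mid \bot$ with $R\in\sigma$. $\#\mathsf{RH\Pi_1}$ is the class of counting functions $f$ expressible as $f(\mathcal{A})=|\{\langle \vec X,\vec x\rangle : \mathcal{A}\models \forall \vec y\,\psi(\vec y,\vec x,\vec X)\}|$, where $\vec X$ is a tuple of second-order variables, $\vec x,\vec y$ tuples of first-order variables, and $\psi$ is an unquantified CNF formula in which each clause has at most one occurrence of an unnegated atom $X(\vec t)$ with $X$ from $\vec X$ and at most one occurrence of a negated such atom. $\mathsf{\Sigma QSO(\Sigma_2\text{ - }2SAT)}$: a literal is $X(\vec x)$ or $\neg X(\vec x)$ with $X$ a second-order variable. A 2SAT clause over $\sigma$ is a formula $\phi_1\vee\phi_2\vee\phi_3$ where each $\phi_i$ is either a literal or a first-order formula over $\sigma$, and at least one $\phi_i$ is a first-order formula over $\sigma$. A $\Sigma_2$-2SAT formula is $\exists\vec x\forall\vec y\bigwedge_{j=1}^k C_j(\vec x,\vec y)$ with $k\in\mathbb{N}$ and each $C_j$ a 2SAT clause. $\mathsf{\Sigma QSO(\Sigma_2\text{ - }2SAT)}$ formulae are given by $\alpha ::= \phi \mid s \mid (\alpha+\alpha)\mid \Sigma x.\alpha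 \mid \Sigma X.\alpha$, where $\phi$ is a $\Sigma_2$-2SAT formula, $s\in\mathbb{N}$, $x$ a first-order and $X$ a second-order variable. Semantics on a structure $\mathcal{A}$ with universe $A$, first-order assignment $v$ and second-order assignment $V$: $[[\phi]](\mathcal{A},v,V)=1$ if $(\mathcal{A},v,V)\models\phi$ and $0$ otherwise; $[[s]]=s$; $[[\alpha_1+\alpha_2]]=[[\alpha_1]]+[[\alpha_2]]$; $[[\Sigma x.\alpha]](\mathcal{A},v,V)=\sum_{a\in A}[[\alpha]](\mathcal{A},v[a/x],V)$; $[[\Sigma X.\alpha]](\mathcal{A},v,V)=\sum_{B\subseteq A^{\mathrm{arity}(X)}}[[\alpha]](\mathcal{A},v,V[B/X])$. For a sentence $\alpha$ (no free variables) this defines a counting function $\mathcal{A}\mapsto[[\alpha]](\mathcal{A})$; $\mathsf{\Sigma QSO(\Sigma_2\text{ - }2SAT)}$ is the class of all such functions (over all vocabularies $\sigma$). -}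

module Defs where

open import Data.Nat using (ℕ; zero; suc; _+_; _≤ᵇ_)
open import Data.Fin using (Fin; toℕ)
open import Data.Fin.Properties using () renaming (_≟_ to _≟F_)
open import Data.Vec using (Vec; []; _∷_; _++_; lookup) renaming (map to vmap)
open import Data.Vec.Properties using (≡-dec)
open import Data.List using (List; []; _∷_; map; concatMap; allFin)
open import Data.Nat.ListAction using (sum)
open import Data.Bool.ListAction using (all; any)
open import Data.List.Membership.Propositional using (_∈_)
open import Data.List.Relation.Unary.All using (All; []; _∷_) renaming (lookup to lookupAll)
open import Data.Bool using (Bool; true; false; if_then_else_; _∧_; _∨_; not)
open import Data.Maybe using (Maybe; just; nothing)
open import Data.Product using (Σ; _×_; _,_)
open import Data.Sum using (_⊎_)
open import Data.Unit using (⊤)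
open import Data.Empty using (⊥)
open import Relation.Nullary using (does)
open import Relation.Binary.PropositionalEquality using (_≡_)
open import Relation.Binary.Definitions using (DecidableEquality)

-- A relational vocabulary: finitely many symbols with arities.
-- The order symbol ≤ is always present (structures are ordered).
record Vocabulary : Set where
  field
    nsym : ℕ
    ar   : Fin nsym → ℕ

open Vocabulary

data Sym (σ : Vocabulary) : Set where
  ≤ₛ : Sym σ
  rₛ : Fin (nsym σ) → Sym σ

arity : ∀ {σ} → Sym σ → ℕ
arity ≤ₛ = 2
arity {σ} (rₛ i) = ar σ i

-- A finite ordered σ-structure: universe {0,…,size} (nonempty), ordered
-- by the natural order, with an interpretation of each symbol.
record Structure (σ : Vocabulary) : Set where
  field
    size : ℕ
    rel  : (i : Fin (nsym σ)) → Vec (Fin (suc size)) (ar σ i) → Bool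

open Structure

U : ∀ {σ} → Structure σ → Set
U A = Fin (suc (size A))

elems : ∀ {σ} (A : Structure σ) → List (U A)
elems A = allFin (suc (size A))

interp : ∀ {σ} (A : Structure σ) (R : Sym σ) → Vec (U A) (arity R) → Bool
interp A ≤ₛ (a ∷ b ∷ []) = toℕ a ≤ᵇ toℕ b
interp A (rₛ i) t = rel A i t

allVec : (m k : ℕ) → List (Vec (Fin m) k)
allVec m zero = [] ∷ []
allVec m (suc k) = concatMap (λ i → map (i ∷_) (allVec m k)) (allFin m)

Rel : ∀ {σ} → Structure σ → ℕ → Set
Rel A k = Vec (U A) k → Bool

-- Sum of F(P) over all predicates P on a finite domain listed by ts
-- (P agrees with the given P₀ outside ts).
sumPreds : {D : Set} → DecidableEquality D → List D → ((D → Bool) → ℕ) → (D → Bool) → ℕ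
sumPreds _≟_ [] F P = F P
sumPreds _≟_ (t ∷ ts) F P =
  sumPreds _≟_ ts F (λ u → if does (u ≟ t) then true else P u)
  + sumPreds _≟_ ts F (λ u → if does (u ≟ t) then false else P u)

sumRel : ∀ {σ} (A : Structure σ) (k : ℕ) → (Rel A k → ℕ) → ℕ
sumRel A k F = sumPreds (≡-dec _≟F_) (allVec (suc (size A)) k) F (λ _ → false)

SOEnv : ∀ {σ} → Structure σ → List ℕ → Set
SOEnv A Δ = All (Rel A) Δ

sumSO : ∀ {σ} (A : Structure σ) (Δ : List ℕ) → (SOEnv A Δ → ℕ) → ℕ
sumSO A [] F = F []
sumSO A (k ∷ Δ) F = sumRel A k (λ P → sumSO A Δ (λ V → F (P ∷ V)))

data FO (σ : Vocabulary) (n : ℕ) : Set where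
  eqᶠ  : Fin n → Fin n → FO σ n
  relᶠ : (R : Sym σ) → Vec (Fin n) (arity R) → FO σ n
  ¬ᶠ   : FO σ n → FO σ n
  _∨ᶠ_ : FO σ n → FO σ n → FO σ n
  ∃ᶠ   : FO σ (suc n) → FO σ n
  ⊤ᶠ   : FO σ n
  ⊥ᶠ   : FO σ n

evalFO : ∀ {σ n} (A : Structure σ) → FO σ n → Vec (U A) n → Bool
evalFO A (eqᶠ i j) ρ = does (lookup ρ i ≟F lookup ρ j)
evalFO A (relᶠ R ts) ρ = interp A R (vmap (lookup ρ) ts)
evalFO A (¬ᶠ φ) ρ = not (evalFO A φ ρ)
evalFO A (φ ∨ᶠ ψ) ρ = evalFO A φ ρ ∨ evalFO A ψ ρ
evalFO A (∃ᶠ φ) ρ = any (λ a → evalFO A φ (a ∷ ρ)) (elems A)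
evalFO A ⊤ᶠ ρ = true
evalFO A ⊥ᶠ ρ = false

data SOAtom (Δ : List ℕ) (n : ℕ) : Set where
  soAtom : ∀ {k} → k ∈ Δ → Vec (Fin n) k → SOAtom Δ n

evalSO : ∀ {σ Δ n} (A : Structure σ) → SOAtom Δ n → Vec (U A) n → SOEnv A Δ → Bool
evalSO A (soAtom X ts) ρ V = lookupAll V X (vmap (lookup ρ) ts)

data Atom (σ : Vocabulary) (n : ℕ) : Set where
  eqₐ  : Fin n → Fin n → Atom σ n
  relₐ : (R : Sym σ) → Vec (Fin n) (arity R) → Atom σ n
  ⊤ₐ   : Atom σ n
  ⊥ₐ   : Atom σ n

evalAtom : ∀ {σ n} (A : Structure σ) → Atom σ n → Vec (U A) n → Bool
evalAtom A (eqₐ i j) ρ = does (lookup ρ i ≟F lookup ρ j)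
evalAtom A (relₐ R ts) ρ = interp A R (vmap (lookup ρ) ts)
evalAtom A ⊤ₐ ρ = true
evalAtom A ⊥ₐ ρ = false

record FOLit (σ : Vocabulary) (n : ℕ) : Set where
  field
    positive : Bool
    atom     : Atom σ n

evalFOLit : ∀ {σ n} (A : Structure σ) → FOLit σ n → Vec (U A) n → Bool
evalFOLit A l ρ = if FOLit.positive l then evalAtom A (FOLit.atom l) ρ
                  else not (evalAtom A (FOLit.atom l) ρ)

record HornClause (σ : Vocabulary) (Δ : List ℕ) (n : ℕ) : Set where
  field
    foLits : List (FOLit σ n)
    posX   : Maybe (SOAtom Δ n)
    negX   : Maybe (SOAtom Δ n)

evalHorn : ∀ {σ Δ n} (A : Structure σ) → HornClause σ Δ n → Vec (U A) n → SOEnv A Δ → Bool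
evalHorn A c ρ V =
  any (λ l → evalFOLit A l ρ) (HornClause.foLits c)
  ∨ posPart (HornClause.posX c) ∨ negPart (HornClause.negX c)
  where
  posPart : _ → Bool
  posPart nothing = false
  posPart (just a) = evalSO A a ρ V
  negPart : _ → Bool
  negPart nothing = false
  negPart (just a) = not (evalSO A a ρ V)

-- An RHΠ₁ counting formula: second-order variables X⃗ with arities Δ,
-- free first-order variables x⃗ (q of them), universal y⃗ (r of them),
-- matrix ψ a CNF (list of clauses) over variables y⃗ ++ x⃗.
record RHΠ₁ (σ : Vocabulary) : Set where
  field
    Δ       : List ℕ
    q       : ℕ
    r       : ℕ
    clauses : List (HornClause σ Δ (r + q))

countRHΠ₁ : ∀ {σ} → RHΠ₁ σ → Structure σ → ℕ
countRHΠ₁ Φ A =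
  sumSO A Δ (λ V → sum (map (λ xs →
    if all (λ ys → all (λ c → evalHorn A c (ys ++ xs) V) clauses)
           (allVec (suc (Structure.size A)) r)
    then 1 else 0) (allVec (suc (Structure.size A)) q)))
  where open RHΠ₁ Φ

#RHΠ₁ : (σ : Vocabulary) → (Structure σ → ℕ) → Set
#RHΠ₁ σ f = Σ (RHΠ₁ σ) (λ Φ → ∀ A → f A ≡ countRHΠ₁ Φ A)

data Literal (Δ : List ℕ) (n : ℕ) : Set where
  posL : SOAtom Δ n → Literal Δ n
  negL : SOAtom Δ n → Literal Δ n

data Disjunct (σ : Vocabulary) (Δ : List ℕ) (n : ℕ) : Set where
  litD : Literal Δ n → Disjunct σ Δ n
  foD  : FO σ n → Disjunct σ Δ n

IsFO : ∀ {σ Δ n} → Disjunct σ Δ n → Set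
IsFO (litD _) = ⊥
IsFO (foD _) = ⊤

record Clause2 (σ : Vocabulary) (Δ : List ℕ) (n : ℕ) : Set where
  field
    φ₁ φ₂ φ₃ : Disjunct σ Δ n
    hasFO    : IsFO φ₁ ⊎ IsFO φ₂ ⊎ IsFO φ₃

evalDisj : ∀ {σ Δ n} (A : Structure σ) → Disjunct σ Δ n → Vec (U A) n → SOEnv A Δ → Bool
evalDisj A (litD (posL a)) ρ V = evalSO A a ρ V
evalDisj A (litD (negL a)) ρ V = not (evalSO A a ρ V)
evalDisj A (foD φ) ρ V = evalFO A φ ρ

evalClause2 : ∀ {σ Δ n} (A : Structure σ) → Clause2 σ Δ n → Vec (U A) n → SOEnv A Δ → Bool
evalClause2 A c ρ V = evalDisj A (Clause2.φ₁ c) ρ V ∨ evalDisj A (Clause2.φ₂ c) ρ V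
                      ∨ evalDisj A (Clause2.φ₃ c) ρ V

-- Σ₂-2SAT formula ∃x⃗ ∀y⃗ ⋀ C_j in a context of n first-order variables and
-- second-order variables of arities Δ; x⃗ has p, y⃗ has q variables;
-- clause variables are y⃗ ++ x⃗ ++ (context).
record Σ₂2SAT (σ : Vocabulary) (n : ℕ) (Δ : List ℕ) : Set where
  field
    p       : ℕ
    q       : ℕ
    clauses : List (Clause2 σ Δ (q + (p + n)))

evalΣ₂2SAT : ∀ {σ n Δ} (A : Structure σ) → Σ₂2SAT σ n Δ → Vec (U A) n → SOEnv A Δ → Bool
evalΣ₂2SAT A φ ρ V =
  any (λ xs → all (λ ys → all (λ c → evalClause2 A c (ys ++ (xs ++ ρ)) V) clauses)
                  (allVec (suc (Structure.size A)) q))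
      (allVec (suc (Structure.size A)) p)
  where open Σ₂2SAT φ

-- ΣQSO(Σ₂-2SAT) formulae with n free first-order variables and free
-- second-order variables of arities Δ (de Bruijn); sentences: n = 0, Δ = [].
data ΣQSO (σ : Vocabulary) : ℕ → List ℕ → Set where
  sat  : ∀ {n Δ} → Σ₂2SAT σ n Δ → ΣQSO σ n Δ
  num  : ∀ {n Δ} → ℕ → ΣQSO σ n Δ
  _⊕_  : ∀ {n Δ} → ΣQSO σ n Δ → ΣQSO σ n Δ → ΣQSO σ n Δ
  Σx   : ∀ {n Δ} → ΣQSO σ (suc n) Δ → ΣQSO σ n Δ
  ΣX   : ∀ {n Δ} (k : ℕ) → ΣQSO σ n (k ∷ Δ) → ΣQSO σ n Δ

⟦_⟧ : ∀ {σ n Δ} → ΣQSO σ n Δ → (A : Structure σ) → Vec (U A) n → SOEnv A Δ → ℕ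
⟦ sat φ ⟧ A ρ V = if evalΣ₂2SAT A φ ρ V then 1 else 0
⟦ num s ⟧ A ρ V = s
⟦ α ⊕ β ⟧ A ρ V = ⟦ α ⟧ A ρ V + ⟦ β ⟧ A ρ V
⟦ Σx α ⟧ A ρ V = sum (map (λ a → ⟦ α ⟧ A (a ∷ ρ) V) (elems A))
⟦ ΣX k α ⟧ A ρ V = sumRel A k (λ B → ⟦ α ⟧ A ρ (B ∷ V))

ΣQSO-Σ₂2SAT : (σ : Vocabulary) → (Structure σ → ℕ) → Set
ΣQSO-Σ₂2SAT σ f = Σ (ΣQSO σ 0 []) (λ α → ∀ A → f A ≡ ⟦ α ⟧ A [] [])

module Submission where

-- Let f(A) = |{⟨X⃗, x⃗⟩ : A ⊨ ∀y⃗ ψ(y⃗, x⃗, X⃗)}| with ψ a CNF of RHΠ₁ clauses.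
-- Each such clause is  ⋁ℓᵢ ∨ X(t⃗) ∨ ¬Y(s⃗)  with ℓᵢ first-order literals, so it
-- is a 2SAT clause whose first-order disjunct is ⋁ℓᵢ (the empty disjunction
-- being ⊥, as is each missing second-order literal).  Hence ∀y⃗ ψ is a
-- Σ₂-2SAT formula (with an empty ∃-block) ψ', and
--     f  =  Σ X₁ … Σ Xₘ . Σ x₁ … Σ x_q . ψ'.

open import Defs
open import Data.Nat using (ℕ; zero; suc; _+_)
open import Data.Nat.Properties using (+-identityʳ; +-cancelˡ-≡; +-commutativeSemigroup)
open import Algebra.Properties.CommutativeSemigroup +-commutativeSemigroup using (interchange)
open import Data.Vec using (Vec; []; _∷_; _++_)
open import Data.Fin using (Fin)
open import Data.List using (List; []; _∷_; map; concatMap; allFin) renaming (_++_ to _++ᴸ_)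
open import Data.List.Properties using (map-cong; map-∘; map-++)
open import Data.Nat.ListAction using (sum)
open import Data.Nat.ListAction.Properties using (sum-++)
open import Data.Bool.ListAction using (all; any; and)
open import Data.List.Relation.Unary.All using ([]; _∷_)
open import Data.Bool using (Bool; true; false; if_then_else_; _∨_; not)
open import Data.Bool.Properties using (∨-identityʳ)
open import Data.Maybe using (Maybe; just; nothing)
open import Data.Product using (_,_)
open import Data.Sum using (inj₁)
open import Data.Unit using (tt)
open import Relation.Binary.PropositionalEquality
  using (_≡_; refl; sym; trans; cong; cong₂; module ≡-Reasoning)
open import Relation.Binary.Definitions using (DecidableEquality)
open import Relation.Nullary using (does)

open ≡-Reasoning

Additive : {X : Set} → ((X → ℕ) → ℕ) → Set
Additive {X} S = (g h : X → ℕ) → S (λ x → g x + h x) ≡ S g + S h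

-- An additive operator sends the zero function to zero (cancel S 0
-- from S 0 + 0 = S 0 + S 0).
additive-zero : {X : Set} (S : (X → ℕ) → ℕ) → Additive S → S (λ _ → 0) ≡ 0
additive-zero S add =
  sym (+-cancelˡ-≡ (S (λ _ → 0)) 0 (S (λ _ → 0))
        (trans (+-identityʳ _) (add (λ _ → 0) (λ _ → 0))))

sum-map-additive : {X : Set} (l : List X) → Additive (λ g → sum (map g l))
sum-map-additive []      g h = refl
sum-map-additive (x ∷ l) g h = begin
  g x + h x + sum (map (λ y → g y + h y) l)
    ≡⟨ cong (g x + h x +_) (sum-map-additive l g h) ⟩
  g x + h x + (sum (map g l) + sum (map h l))
    ≡⟨ interchange (g x) (h x) (sum (map g l)) (sum (map h l)) ⟩
  g x + sum (map g l) + (h x + sum (map h l)) ∎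

sum-map-commute : {X Y : Set} (S : (Y → ℕ) → ℕ) → Additive S →
  (F : X → Y → ℕ) (l : List X) →
  sum (map (λ x → S (F x)) l) ≡ S (λ y → sum (map (λ x → F x y) l))
sum-map-commute S add F []      = sym (additive-zero S add)
sum-map-commute S add F (x ∷ l) = begin
  S (F x) + sum (map (λ x → S (F x)) l)
    ≡⟨ cong (S (F x) +_) (sum-map-commute S add F l) ⟩
  S (F x) + S (λ y → sum (map (λ x → F x y) l))
    ≡⟨ sym (add (F x) (λ y → sum (map (λ x → F x y) l))) ⟩
  S (λ y → F x y + sum (map (λ x → F x y) l)) ∎

sum-concatMap : {X Y : Set} (f : Y → ℕ) (g : X → List Y) (l : List X) →
  sum (map f (concatMap g l)) ≡ sum (map (λ x → sum (map f (g x))) l)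
sum-concatMap f g []      = refl
sum-concatMap f g (x ∷ l) = begin
  sum (map f (g x ++ᴸ concatMap g l))
    ≡⟨ cong sum (map-++ f (g x) (concatMap g l)) ⟩
  sum (map f (g x) ++ᴸ map f (concatMap g l))
    ≡⟨ sum-++ (map f (g x)) (map f (concatMap g l)) ⟩
  sum (map f (g x)) + sum (map f (concatMap g l))
    ≡⟨ cong (sum (map f (g x)) +_) (sum-concatMap f g l) ⟩
  sum (map f (g x)) + sum (map (λ x → sum (map f (g x))) l) ∎

sum-allVec-suc : (m k : ℕ) (f : Vec (Fin m) (suc k) → ℕ) →
  sum (map f (allVec m (suc k)))
    ≡ sum (map (λ a → sum (map (λ xs → f (a ∷ xs)) (allVec m k))) (allFin m))
sum-allVec-suc m k f = begin
  sum (map f (allVec m (suc k)))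
    ≡⟨ sum-concatMap f (λ a → map (a ∷_) (allVec m k)) (allFin m) ⟩
  sum (map (λ a → sum (map f (map (a ∷_) (allVec m k)))) (allFin m))
    ≡⟨ cong sum (map-cong (λ a → cong sum (sym (map-∘ (allVec m k)))) (allFin m)) ⟩
  sum (map (λ a → sum (map (λ xs → f (a ∷ xs)) (allVec m k))) (allFin m)) ∎

sumPreds-cong : {D : Set} (_≟_ : DecidableEquality D) (ts : List D)
  {F G : (D → Bool) → ℕ} → (∀ P → F P ≡ G P) → ∀ P →
  sumPreds _≟_ ts F P ≡ sumPreds _≟_ ts G P
sumPreds-cong _≟_ []       F≗G P = F≗G P
sumPreds-cong _≟_ (t ∷ ts) F≗G P =
  cong₂ _+_ (sumPreds-cong _≟_ ts F≗G _) (sumPreds-cong _≟_ ts F≗G _)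

sumRel-cong : ∀ {σ} (A : Structure σ) k {F G : Rel A k → ℕ} →
  (∀ P → F P ≡ G P) → sumRel A k F ≡ sumRel A k G
sumRel-cong A k F≗G = sumPreds-cong _ (allVec (suc (Structure.size A)) k) F≗G _

sumSO-cong : ∀ {σ} (A : Structure σ) Δ {F G : SOEnv A Δ → ℕ} →
  (∀ V → F V ≡ G V) → sumSO A Δ F ≡ sumSO A Δ G
sumSO-cong A []      F≗G = F≗G []
sumSO-cong A (k ∷ Δ) F≗G = sumRel-cong A k (λ P → sumSO-cong A Δ (λ V → F≗G (P ∷ V)))

sumPreds-additive : {D : Set} (_≟_ : DecidableEquality D) (ts : List D) (P : D → Bool) →
  Additive (λ F → sumPreds _≟_ ts F P)
sumPreds-additive _≟_ []       P F G = refl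
sumPreds-additive {D} _≟_ (t ∷ ts) P F G =
  trans (cong₂ _+_ (sumPreds-additive _≟_ ts P₁ F G) (sumPreds-additive _≟_ ts P₀ F G))
        (interchange (S F P₁) (S G P₁) (S F P₀) (S G P₀))
  where
  S : ((D → Bool) → ℕ) → (D → Bool) → ℕ
  S = sumPreds _≟_ ts
  P₁ P₀ : D → Bool
  P₁ u = if does (u ≟ t) then true else P u
  P₀ u = if does (u ≟ t) then false else P u

sumRel-additive : ∀ {σ} (A : Structure σ) k → Additive (sumRel A k)
sumRel-additive A k = sumPreds-additive _ (allVec (suc (Structure.size A)) k) _

sumPreds-commute : {D Y : Set} (_≟_ : DecidableEquality D) (ts : List D)
  (S : (Y → ℕ) → ℕ) → Additive S → (F : (D → Bool) → Y → ℕ) (P : D → Bool) →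
  sumPreds _≟_ ts (λ Q → S (F Q)) P ≡ S (λ y → sumPreds _≟_ ts (λ Q → F Q y) P)
sumPreds-commute _≟_ []       S add F P = refl
sumPreds-commute _≟_ (t ∷ ts) S add F P =
  trans (cong₂ _+_ (sumPreds-commute _≟_ ts S add F _) (sumPreds-commute _≟_ ts S add F _))
        (sym (add _ _))

sumSO-commute : ∀ {σ} {Y : Set} (A : Structure σ) Δ
  (S : (Y → ℕ) → ℕ) → Additive S → (F : SOEnv A Δ → Y → ℕ) →
  sumSO A Δ (λ V → S (F V)) ≡ S (λ y → sumSO A Δ (λ V → F V y))
sumSO-commute A []      S add F = refl
sumSO-commute A (k ∷ Δ) S add F = begin
  sumRel A k (λ P → sumSO A Δ (λ V → S (F (P ∷ V))))
    ≡⟨ sumRel-cong A k (λ P → sumSO-commute A Δ S add (λ V → F (P ∷ V))) ⟩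
  sumRel A k (λ P → S (λ y → sumSO A Δ (λ V → F (P ∷ V) y)))
    ≡⟨ sumPreds-commute _ (allVec (suc (Structure.size A)) k) S add
         (λ P y → sumSO A Δ (λ V → F (P ∷ V) y)) (λ _ → false) ⟩
  S (λ y → sumRel A k (λ P → sumSO A Δ (λ V → F (P ∷ V) y))) ∎

Σxs : ∀ {σ Δ} k → ΣQSO σ k Δ → ΣQSO σ 0 Δ
Σxs zero    α = α
Σxs (suc k) α = Σxs k (Σx α)

Σxs-sem : ∀ {σ Δ} k (α : ΣQSO σ k Δ) (A : Structure σ) (V : SOEnv A Δ) →
  ⟦ Σxs k α ⟧ A [] V ≡ sum (map (λ xs → ⟦ α ⟧ A xs V) (allVec (suc (Structure.size A)) k))
Σxs-sem zero    α A V = sym (+-identityʳ _)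
Σxs-sem (suc k) α A V = begin
  ⟦ Σxs k (Σx α) ⟧ A [] V
    ≡⟨ Σxs-sem k (Σx α) A V ⟩
  sum (map (λ xs → sum (map (λ a → ⟦ α ⟧ A (a ∷ xs) V) (elems A))) (allVec _ k))
    ≡⟨ sum-map-commute (λ g → sum (map g (elems A))) (sum-map-additive (elems A))
         (λ xs a → ⟦ α ⟧ A (a ∷ xs) V) (allVec _ k) ⟩
  sum (map (λ a → sum (map (λ xs → ⟦ α ⟧ A (a ∷ xs) V) (allVec _ k))) (elems A))
    ≡⟨ sym (sum-allVec-suc _ k (λ xs → ⟦ α ⟧ A xs V)) ⟩
  sum (map (λ xs → ⟦ α ⟧ A xs V) (allVec _ (suc k))) ∎

ΣXs : ∀ {σ n} Δ → ΣQSO σ n Δ → ΣQSO σ n []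
ΣXs []      α = α
ΣXs (k ∷ Δ) α = ΣXs Δ (ΣX k α)

ΣXs-sem : ∀ {σ n} Δ (α : ΣQSO σ n Δ) (A : Structure σ) (ρ : Vec (U A) n) →
  ⟦ ΣXs Δ α ⟧ A ρ [] ≡ sumSO A Δ (⟦ α ⟧ A ρ)
ΣXs-sem []      α A ρ = refl
ΣXs-sem (k ∷ Δ) α A ρ = begin
  ⟦ ΣXs Δ (ΣX k α) ⟧ A ρ []
    ≡⟨ ΣXs-sem Δ (ΣX k α) A ρ ⟩
  sumSO A Δ (λ V → sumRel A k (λ B → ⟦ α ⟧ A ρ (B ∷ V)))
    ≡⟨ sumSO-commute A Δ (sumRel A k) (sumRel-additive A k) (λ V B → ⟦ α ⟧ A ρ (B ∷ V)) ⟩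
  sumRel A k (λ B → sumSO A Δ (λ V → ⟦ α ⟧ A ρ (B ∷ V))) ∎

module _ {σ : Vocabulary} {Δ : List ℕ} {n : ℕ} where

  atomFO : Atom σ n → FO σ n
  atomFO (eqₐ i j)   = eqᶠ i j
  atomFO (relₐ R ts) = relᶠ R ts
  atomFO ⊤ₐ          = ⊤ᶠ
  atomFO ⊥ₐ          = ⊥ᶠ

  litFO : FOLit σ n → FO σ n
  litFO record { positive = true  ; atom = a } = atomFO a
  litFO record { positive = false ; atom = a } = ¬ᶠ (atomFO a)

  litsFO : List (FOLit σ n) → FO σ n
  litsFO []       = ⊥ᶠ
  litsFO (l ∷ ls) = litFO l ∨ᶠ litsFO ls

  posD negD : Maybe (SOAtom Δ n) → Disjunct σ Δ n
  posD nothing  = foD ⊥ᶠ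
  posD (just a) = litD (posL a)
  negD nothing  = foD ⊥ᶠ
  negD (just a) = litD (negL a)

  toClause2 : HornClause σ Δ n → Clause2 σ Δ n
  toClause2 c = record
    { φ₁    = foD (litsFO (HornClause.foLits c))
    ; φ₂    = posD (HornClause.posX c)
    ; φ₃    = negD (HornClause.negX c)
    ; hasFO = inj₁ tt }

  module _ (A : Structure σ) (ρ : Vec (U A) n) (V : SOEnv A Δ) where

    atomFO-correct : ∀ a → evalFO A (atomFO a) ρ ≡ evalAtom A a ρ
    atomFO-correct (eqₐ i j)   = refl
    atomFO-correct (relₐ R ts) = refl
    atomFO-correct ⊤ₐ          = refl
    atomFO-correct ⊥ₐ          = refl

    litFO-correct : ∀ l → evalFO A (litFO l) ρ ≡ evalFOLit A l ρ
    litFO-correct record { positive = true  ; atom = a } = atomFO-correct a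
    litFO-correct record { positive = false ; atom = a } = cong not (atomFO-correct a)

    litsFO-correct : ∀ ls → evalFO A (litsFO ls) ρ ≡ any (λ l → evalFOLit A l ρ) ls
    litsFO-correct []       = refl
    litsFO-correct (l ∷ ls) = cong₂ _∨_ (litFO-correct l) (litsFO-correct ls)

    toClause2-correct : ∀ c → evalClause2 A (toClause2 c) ρ V ≡ evalHorn A c ρ V
    toClause2-correct record { foLits = ls ; posX = nothing ; negX = nothing } =
      cong (_∨ false) (litsFO-correct ls)
    toClause2-correct record { foLits = ls ; posX = just a ; negX = nothing } =
      cong (_∨ (evalSO A a ρ V ∨ false)) (litsFO-correct ls)
    toClause2-correct record { foLits = ls ; posX = nothing ; negX = just b } =
      cong (_∨ (false ∨ not (evalSO A b ρ V))) (litsFO-correct ls)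
    toClause2-correct record { foLits = ls ; posX = just a ; negX = just b } =
      cong (_∨ (evalSO A a ρ V ∨ not (evalSO A b ρ V))) (litsFO-correct ls)

matrixΣ₂ : ∀ {σ} (Φ : RHΠ₁ σ) → Σ₂2SAT σ (RHΠ₁.q Φ) (RHΠ₁.Δ Φ)
matrixΣ₂ Φ = record { p = 0 ; q = RHΠ₁.r Φ ; clauses = map toClause2 (RHΠ₁.clauses Φ) }

matrixΣ₂-correct : ∀ {σ} (Φ : RHΠ₁ σ) (A : Structure σ) xs V →
  evalΣ₂2SAT A (matrixΣ₂ Φ) xs V
    ≡ all (λ ys → all (λ c → evalHorn A c (ys ++ xs) V) (RHΠ₁.clauses Φ))
          (allVec (suc (Structure.size A)) (RHΠ₁.r Φ))
matrixΣ₂-correct Φ A xs V = begin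
  all (λ ys → all (λ c → evalClause2 A c (ys ++ xs) V) (map toClause2 clauses)) (allVec _ r) ∨ false
    ≡⟨ ∨-identityʳ _ ⟩
  all (λ ys → all (λ c → evalClause2 A c (ys ++ xs) V) (map toClause2 clauses)) (allVec _ r)
    ≡⟨ cong and (map-cong (λ ys → cong and (trans (sym (map-∘ clauses))
         (map-cong (toClause2-correct A (ys ++ xs) V) clauses))) (allVec _ r)) ⟩
  all (λ ys → all (λ c → evalHorn A c (ys ++ xs) V) clauses) (allVec _ r) ∎
  where open RHΠ₁ Φ

proposition1 : (σ : Vocabulary) (f : Structure σ → ℕ) →
    #RHΠ₁ σ f → ΣQSO-Σ₂2SAT σ f
proposition1 σ f (Φ , f≡count) = α , λ A → trans (f≡count A) (sym (α-sem A))
  where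
  open RHΠ₁ Φ
  α : ΣQSO σ 0 []
  α = ΣXs Δ (Σxs q (sat (matrixΣ₂ Φ)))
  α-sem : ∀ A → ⟦ α ⟧ A [] [] ≡ countRHΠ₁ Φ A
  α-sem A = begin
    ⟦ α ⟧ A [] []
      ≡⟨ ΣXs-sem Δ _ A [] ⟩
    sumSO A Δ (λ V → ⟦ Σxs q (sat (matrixΣ₂ Φ)) ⟧ A [] V)
      ≡⟨ sumSO-cong A Δ (λ V → trans (Σxs-sem q _ A V)
           (cong sum (map-cong (λ xs → cong (λ b → if b then 1 else 0) (matrixΣ₂-correct Φ A xs V))
                               (allVec _ q)))) ⟩
    countRHΠ₁ Φ A ∎
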